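{- Let $(a_n)_{n\ge 0}$ be a sequence of real numbers with $a_0=1$, let $F(t)=1+\sum_{n\ge1}a_n\frac{t^n}{n!}$, and for every real $\alpha$ define polynomials $f_n^{(\alpha)}(x)$ by $\sum_{n\ge0}f_n^{(\alpha)}(x)\frac{t^n}{n!}=(F(t))^{\alpha}e^{xt}$. Let $L$ be the linear functional on the polynomial ring $\mathbb{R}[x][u]$ (linear over $\mathbb{R}[x]$) determined by $L(u^i)=a_i$ for all $i\ge0$, and for a polynomial $P(u)\in\mathbb{R}[x][u]$ write $P(\mathbf{A})$ for $L(P(u))$. Then for every real $\alpha$, every non-negative integer $n$ and every real $x$, $$f_n^{(\alpha)}(\mathbf{A}+x)=f_n^{(\alpha+1)}(x),$$ $$(\alpha+1)(\mathbf{A}+x)f_n^{(\alpha)}(\mathbf{A}+x)=f_{n+1}^{(\alpha+1)}(x)+\alpha x f_n^{(\alpha+1)}(x),$$ where $f_n^{(\alpha)}(\mathbf{A}+x)=L\big(f_n^{(\alpha)}(u+x)\big)$ and $(\mathbf{A}+x)f_n^{(\alpha)}(\mathbf{A}+x)=L\big((u+x)f_n^{(\alpha)}(u+x)\big)$.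
   Context: Here $(F(t))^\alpha=\exp(\alpha\log F(t))$ as a formal power series (well defined since $F(0)=1$). This is the classical umbral calculus: the umbra $\mathbf{A}$ satisfies $\mathbf{A}^i:=a_i$, applied after expanding a polynomial expression in $\mathbf{A}$. -}

module Defs where

open import Level using (Level)
open import Data.Nat using (ℕ; zero; suc; _∸_)
open import Data.Nat using (_!)
open import Data.List using (List; []; _∷_)
open import Algebra.Bundles using (CommutativeRing)

-- A ℚ-algebra (commutative ring in which every positive integer is
-- invertible): the coefficient ring.  ℝ is an instance.
module Umbral {c ℓ : Level} (R : CommutativeRing c ℓ) (inv : ℕ → CommutativeRing.Carrier R) where
  open CommutativeRing R

  natC : ℕ → Carrier
  natC zero    = 0#
  natC (suc n) = 1# + natC n

  -- inv n is meant to be 1/(n+1); invFact n = 1/n!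
  invFact : ℕ → Carrier
  invFact zero    = 1#
  invFact (suc n) = inv n * invFact n

  sumTo : ℕ → (ℕ → Carrier) → Carrier
  sumTo zero    f = 0#
  sumTo (suc n) f = sumTo n f + f n

  -- Formal power series in t, by ordinary coefficients  [t^n]
  Series : Set c
  Series = ℕ → Carrier

  scaleS : Carrier → Series → Series
  scaleS r f n = r * f n

  mulS : Series → Series → Series
  mulS f g n = sumTo (suc n) (λ k → f k * g (n ∸ k))

  powS : Series → ℕ → Series
  powS f zero    zero    = 1#
  powS f zero    (suc n) = 0#
  powS f (suc k)         = mulS f (powS f k)

  minusOne : Series → Series
  minusOne f zero    = 0#
  minusOne f (suc n) = f (suc n)

  -- log F = Σ_{k≥1} (-1)^{k+1} (F-1)^k / k   (for F(0) = 1)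
  -- coefficient of t^n only involves k ≤ n since (F-1)^k = O(t^k)
  signC : ℕ → Carrier
  signC zero    = 1#
  signC (suc k) = - signC k

  logS : Series → Series
  logS F n = sumTo n (λ k → signC k * (inv k * powS (minusOne F) (suc k) n))

  -- exp H = Σ_{k≥0} H^k / k!   (for H(0) = 0)
  expS : Series → Series
  expS H n = sumTo (suc n) (λ k → invFact k * powS H k n)

  powα : Series → Carrier → Series
  powα F α = expS (scaleS α (logS F))

  genF : (ℕ → Carrier) → Series
  genF a zero    = 1#
  genF a (suc n) = a (suc n) * invFact (suc n)

  -- Polynomials in one variable as coefficient lists (constant term first)
  Poly : Set c
  Poly = List Carrier

  addP : Poly → Poly → Poly
  addP []       q        = q
  addP p        []       = p
  addP (a ∷ p) (b ∷ q)   = (a + b) ∷ addP p q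

  scaleP : Carrier → Poly → Poly
  scaleP r []      = []
  scaleP r (a ∷ p) = (r * a) ∷ scaleP r p

  mulP : Poly → Poly → Poly
  mulP []      q = []
  mulP (a ∷ p) q = addP (scaleP a q) (0# ∷ mulP p q)

  evalP : Poly → Carrier → Carrier
  evalP []      y = 0#
  evalP (a ∷ p) y = a + y * evalP p y

  compP : Poly → Poly → Poly
  compP []      q = []
  compP (a ∷ p) q = addP (a ∷ []) (mulP q (compP p q))

  uPlus : Carrier → Poly
  uPlus x = x ∷ 1# ∷ []

  Lfrom : (ℕ → Carrier) → ℕ → Poly → Carrier
  Lfrom a i []      = 0#
  Lfrom a i (c ∷ p) = c * a i + Lfrom a (suc i) p

  L : (ℕ → Carrier) → Poly → Carrier
  L a = Lfrom a 0

  -- f_n^{(α)}(y) defined by Σ_n f_n^{(α)}(y) t^n/n! = F(t)^α e^{yt}: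
  -- f_n^{(α)}(y) = n! [t^n] (F^α e^{yt}) = Σ_j n!/j! [t^{n-j}]F^α · y^j
  -- coefficient list of f_n^{(α)} as a polynomial in y (indices 0..n)
  fpolyFrom : (ℕ → Carrier) → Carrier → ℕ → ℕ → ℕ → Poly
  fpolyFrom a α n j zero    = []
  fpolyFrom a α n j (suc m) =
    (natC (n !) * (invFact j * powα (genF a) α (n ∸ j))) ∷ fpolyFrom a α n (suc j) m

  fpoly : (ℕ → Carrier) → Carrier → ℕ → Poly
  fpoly a α n = fpolyFrom a α n 0 (suc n)

-- Write E(t) = e^{xt} and A(t) = Σ aₖ tᵏ/k!, which is F since a₀ = 1.  The umbral moments
-- L((u + x)ʲ) are j! [tʲ] A(t)E(t), so by linearity L(f_n^{(α)}(u + x)) = n! [tⁿ] F·F^α·E, while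
-- f_n^{(α+1)}(x) = n! [tⁿ] F^{α+1}·E: the first identity is F^{α+1} = F·F^α.  Multiplying by u + x
-- shifts the moments, i.e. differentiates A·E, and the second identity becomes
-- (α + 1)(F E)′ F^α = (F^{α+1} E)′ + α x F^{α+1} E, a consequence of F·(F^α)′ = α F^α F′.  That
-- differential equation follows from (exp H)′ = exp H · H′ and F·(log F)′ = F′, and since it
-- determines a series with given constant term coefficient by coefficient, it also yields
-- F^{α+1} = F·F^α.

module Submission where

open import Defs
open import Level using (Level)
open import Data.Nat as ℕ using (ℕ; zero; suc; _∸_; _≤_; _<_; z≤n; s≤s; _!)
import Data.Nat.Properties as ℕₚ
open import Data.Sum using (inj₁; inj₂)
open import Data.List using ([]; _∷_)
open import Data.Product using (_×_; _,_)
open import Function using (_∘_)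
open import Relation.Nullary using (yes; no)
open import Relation.Binary.Bundles using (Setoid)
open import Relation.Binary.PropositionalEquality as ≡ using (_≡_)
open import Algebra.Bundles using (CommutativeRing; CommutativeSemiring)
open import Algebra.Structures.Biased using (IsCommutativeSemiringˡ)
import Algebra.Properties.Ring
import Algebra.Properties.CommutativeSemigroup
import Algebra.Solver.Ring.NaturalCoefficients.Default
import Relation.Binary.Reasoning.Setoid

module UmbralCalculus {c ℓ : Level} (R : CommutativeRing c ℓ) (inv : ℕ → CommutativeRing.Carrier R) where
  open CommutativeRing R
  open Umbral R inv
  open Algebra.Properties.Ring ring using (+-cancelˡ; -‿involutive; -‿distribˡ-*; -0#≈0#)
  open Algebra.Properties.CommutativeSemigroup *-commutativeSemigroup using (x∙yz≈y∙xz; x∙yz≈yx∙z)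
  open Algebra.Properties.CommutativeSemigroup +-commutativeSemigroup using () renaming (interchange to +-interchange)
  open Relation.Binary.Reasoning.Setoid setoid
  open Algebra.Solver.Ring.NaturalCoefficients.Default commutativeSemiring

  sumTo-cong-< : ∀ n {f g} → (∀ k → k < n → f k ≈ g k) → sumTo n f ≈ sumTo n g
  sumTo-cong-< zero    e = refl
  sumTo-cong-< (suc n) e = +-cong (sumTo-cong-< n (λ k k<n → e k (ℕₚ.m<n⇒m<1+n k<n))) (e n ℕₚ.≤-refl)

  sumTo-cong : ∀ n {f g} → (∀ k → f k ≈ g k) → sumTo n f ≈ sumTo n g
  sumTo-cong n e = sumTo-cong-< n (λ k _ → e k)

  sumTo-zero : ∀ n {f} → (∀ k → k < n → f k ≈ 0#) → sumTo n f ≈ 0#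
  sumTo-zero zero    e = refl
  sumTo-zero (suc n) e =
    trans (+-cong (sumTo-zero n (λ k k<n → e k (ℕₚ.m<n⇒m<1+n k<n))) (e n ℕₚ.≤-refl)) (+-identityˡ 0#)

  sumTo-+ : ∀ n f g → sumTo n (λ k → f k + g k) ≈ sumTo n f + sumTo n g
  sumTo-+ zero    f g = sym (+-identityˡ 0#)
  sumTo-+ (suc n) f g = begin
    sumTo n (λ k → f k + g k) + (f n + g n) ≈⟨ +-cong (sumTo-+ n f g) refl ⟩
    (sumTo n f + sumTo n g) + (f n + g n)   ≈⟨ +-interchange _ _ _ _ ⟩
    (sumTo n f + f n) + (sumTo n g + g n)   ∎

  sumTo-*ˡ : ∀ n r f → sumTo n (λ k → r * f k) ≈ r * sumTo n f
  sumTo-*ˡ zero    r f = sym (zeroʳ r)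
  sumTo-*ˡ (suc n) r f = trans (+-cong (sumTo-*ˡ n r f) refl) (sym (distribˡ r _ _))

  sumTo-*ʳ : ∀ n r f → sumTo n (λ k → f k * r) ≈ sumTo n f * r
  sumTo-*ʳ n r f = trans (sumTo-cong n (λ k → *-comm _ _)) (trans (sumTo-*ˡ n r f) (*-comm _ _))

  sumTo-head : ∀ n f → sumTo (suc n) f ≈ f 0 + sumTo n (f ∘ suc)
  sumTo-head zero    f = trans (+-identityˡ _) (sym (+-identityʳ _))
  sumTo-head (suc n) f = trans (+-cong (sumTo-head n f) refl) (+-assoc _ _ _)

  sumTo-extend : ∀ m n {f} → m ≤ n → (∀ k → m ≤ k → f k ≈ 0#) → sumTo n f ≈ sumTo m f
  sumTo-extend m zero    z≤n e = refl
  sumTo-extend m (suc n) m≤ e with ℕₚ.m≤n⇒m<n∨m≡n m≤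
  ... | inj₂ ≡.refl       = refl
  ... | inj₁ (s≤s m≤n) = trans (+-cong (sumTo-extend m n m≤n e) (e n m≤n)) (+-identityʳ _)

  sumTo-swap : ∀ m n (f : ℕ → ℕ → Carrier) →
    sumTo m (λ i → sumTo n (f i)) ≈ sumTo n (λ k → sumTo m (λ i → f i k))
  sumTo-swap zero    n f = sym (sumTo-zero n (λ _ _ → refl))
  sumTo-swap (suc m) n f = trans (+-cong (sumTo-swap m n f) refl) (sym (sumTo-+ n _ _))

  sumTo-reverse : ∀ m f → sumTo m f ≈ sumTo m (λ k → f (m ∸ suc k))
  sumTo-reverse zero    f = refl
  sumTo-reverse (suc m) f = begin
    sumTo m f + f m                     ≈⟨ +-cong (sumTo-reverse m f) refl ⟩
    sumTo m (λ k → f (m ∸ suc k)) + f m ≈⟨ +-comm _ _ ⟩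
    f m + sumTo m (λ k → f (m ∸ suc k)) ≈⟨ sumTo-head m (λ k → f (m ∸ k)) ⟨
    sumTo (suc m) (λ k → f (m ∸ k))     ∎

  sumTo-telescope : ∀ m (h : ℕ → Carrier) → sumTo m (λ k → h k - h (suc k)) ≈ h 0 - h m
  sumTo-telescope zero    h = sym (-‿inverseʳ (h 0))
  sumTo-telescope (suc m) h = begin
    sumTo m (λ k → h k - h (suc k)) + (h m - h (suc m)) ≈⟨ +-cong (sumTo-telescope m h) refl ⟩
    (h 0 - h m) + (h m - h (suc m))
      ≈⟨ solve 4 (λ a b d e → (a :+ b) :+ (d :+ e) := a :+ e :+ (b :+ d)) refl (h 0) (- h m) (h m) (- h (suc m)) ⟩
    (h 0 - h (suc m)) + (- h m + h m)                   ≈⟨ +-cong refl (-‿inverseˡ (h m)) ⟩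
    (h 0 - h (suc m)) + 0#                              ≈⟨ +-identityʳ _ ⟩
    h 0 - h (suc m)                                     ∎

  sumTo-triangle : ∀ n (f : ℕ → ℕ → Carrier) →
    sumTo (suc n) (λ k → sumTo (suc k) (λ i → f i k)) ≈ sumTo (suc n) (λ i → sumTo (suc (n ∸ i)) (λ j → f i (i ℕ.+ j)))
  sumTo-triangle zero    f = refl
  sumTo-triangle (suc n) f = begin
    sumTo (suc n) (λ k → sumTo (suc k) (λ i → f i k)) + (sumTo (suc n) (λ i → f i (suc n)) + f (suc n) (suc n))
      ≈⟨ +-cong (sumTo-triangle n f) refl ⟩
    inner n + (sumTo (suc n) (λ i → f i (suc n)) + f (suc n) (suc n))
      ≈⟨ +-assoc _ _ _ ⟨
    (inner n + sumTo (suc n) (λ i → f i (suc n))) + f (suc n) (suc n)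
      ≈⟨ +-cong (sym (sumTo-+ (suc n) _ _)) diagonal ⟩
    sumTo (suc n) (λ i → row n i + f i (suc n)) + row (suc n) (suc n)
      ≈⟨ +-cong (sumTo-cong-< (suc n) (λ i i≤n → row-suc (ℕₚ.≤-pred i≤n))) refl ⟩
    sumTo (suc n) (row (suc n)) + row (suc n) (suc n)
      ∎
    where
    row′ : ℕ → ℕ → Carrier
    row′ l i = sumTo (suc l) (λ j → f i (i ℕ.+ j))
    row : ℕ → ℕ → Carrier
    row m i = row′ (m ∸ i) i
    inner : ℕ → Carrier
    inner m = sumTo (suc m) (row m)
    diagonal : f (suc n) (suc n) ≈ row (suc n) (suc n)
    diagonal = begin
      f (suc n) (suc n)                       ≈⟨ reflexive (≡.cong (f (suc n)) (≡.sym (ℕₚ.+-identityʳ (suc n)))) ⟩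
      f (suc n) (suc n ℕ.+ 0)                 ≈⟨ +-identityˡ _ ⟨
      sumTo 1 (λ j → f (suc n) (suc n ℕ.+ j)) ≈⟨ reflexive (≡.cong (λ m → row′ m (suc n)) (≡.sym (ℕₚ.n∸n≡0 n))) ⟩
      row (suc n) (suc n)                     ∎
    row-suc : ∀ {i} → i ≤ n → row n i + f i (suc n) ≈ row (suc n) i
    row-suc {i} i≤n = begin
      row n i + f i (suc n)   ≈⟨ +-cong refl (reflexive (≡.cong (f i) last)) ⟩
      row′ (suc (n ∸ i)) i    ≈⟨ reflexive (≡.cong (λ m → row′ m i) (≡.sym (ℕₚ.+-∸-assoc 1 i≤n))) ⟩
      row (suc n) i           ∎
      where
      last : suc n ≡ i ℕ.+ suc (n ∸ i)
      last = ≡.sym (≡.trans (ℕₚ.+-suc i (n ∸ i)) (≡.cong suc (ℕₚ.m+[n∸m]≡n i≤n)))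

  natC-+ : ∀ m n → natC (m ℕ.+ n) ≈ natC m + natC n
  natC-+ zero    n = sym (+-identityˡ _)
  natC-+ (suc m) n = trans (+-cong refl (natC-+ m n)) (sym (+-assoc _ _ _))

  natC-* : ∀ m n → natC (m ℕ.* n) ≈ natC m * natC n
  natC-* zero    n = sym (zeroˡ _)
  natC-* (suc m) n = begin
    natC (n ℕ.+ m ℕ.* n)     ≈⟨ natC-+ n (m ℕ.* n) ⟩
    natC n + natC (m ℕ.* n)  ≈⟨ +-cong refl (natC-* m n) ⟩
    natC n + natC m * natC n ≈⟨ solve 2 (λ a b → a :+ b :* a := (con 1 :+ b) :* a) refl _ _ ⟩
    (1# + natC m) * natC n   ∎

  natC-∸ : ∀ {k m} → k ≤ m → natC m ≈ natC k + natC (m ∸ k)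
  natC-∸ {k} {m} k≤m = trans (reflexive (≡.cong natC (≡.sym (ℕₚ.m+[n∸m]≡n k≤m)))) (natC-+ k (m ∸ k))

  infix 4 _≋_
  _≋_ : Series → Series → Set ℓ
  f ≋ g = ∀ n → f n ≈ g n

  addS : Series → Series → Series
  addS f g n = f n + g n

  zeroS : Series
  zeroS n = 0#

  constS : Carrier → Series
  constS r zero    = r
  constS r (suc n) = 0#

  oneS : Series
  oneS = constS 1#

  constS-cong : ∀ {r s} → r ≈ s → constS r ≋ constS s
  constS-cong r≈s zero    = r≈s
  constS-cong r≈s (suc n) = refl

  derivS : Series → Series
  derivS f n = natC (suc n) * f (suc n)

  seriesSetoid : Setoid c ℓ
  seriesSetoid = record
    { Carrier       = Series
    ; _≈_           = _≋_
    ; isEquivalence = record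
      { refl  = λ n → refl
      ; sym   = λ e n → sym (e n)
      ; trans = λ e e′ n → trans (e n) (e′ n)
      }
    }

  open Setoid seriesSetoid public using () renaming (refl to ≋-refl; sym to ≋-sym; trans to ≋-trans)

  addS-cong : ∀ {f f′ g g′} → f ≋ f′ → g ≋ g′ → addS f g ≋ addS f′ g′
  addS-cong e e′ n = +-cong (e n) (e′ n)

  mulS-cong : ∀ {f f′ g g′} → f ≋ f′ → g ≋ g′ → mulS f g ≋ mulS f′ g′
  mulS-cong e e′ n = sumTo-cong (suc n) (λ k → *-cong (e k) (e′ (n ∸ k)))

  addS-congˡ : ∀ h {f g} → f ≋ g → addS h f ≋ addS h g
  addS-congˡ h = addS-cong (≋-refl {h})

  addS-congʳ : ∀ h {f g} → f ≋ g → addS f h ≋ addS g h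
  addS-congʳ h e = addS-cong e (≋-refl {h})

  mulS-congˡ : ∀ h {f g} → f ≋ g → mulS h f ≋ mulS h g
  mulS-congˡ h = mulS-cong (≋-refl {h})

  mulS-congʳ : ∀ h {f g} → f ≋ g → mulS f h ≋ mulS g h
  mulS-congʳ h e = mulS-cong e (≋-refl {h})

  mulS-comm : ∀ f g → mulS f g ≋ mulS g f
  mulS-comm f g n = begin
    sumTo (suc n) (λ k → f k * g (n ∸ k))             ≈⟨ sumTo-reverse (suc n) _ ⟩
    sumTo (suc n) (λ k → f (n ∸ k) * g (n ∸ (n ∸ k)))  ≈⟨ sumTo-cong-< (suc n) (λ k k≤n →
       trans (*-comm _ _) (*-cong (reflexive (≡.cong g (ℕₚ.m∸[m∸n]≡n (ℕₚ.≤-pred k≤n)))) refl)) ⟩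
    sumTo (suc n) (λ k → g k * f (n ∸ k))             ∎

  mulS-distribˡ : ∀ f g h → mulS f (addS g h) ≋ addS (mulS f g) (mulS f h)
  mulS-distribˡ f g h n = trans (sumTo-cong (suc n) (λ k → distribˡ _ _ _)) (sumTo-+ (suc n) _ _)

  constS-mulS : ∀ r f → mulS (constS r) f ≋ λ n → r * f n
  constS-mulS r f n = begin
    sumTo (suc n) (λ k → constS r k * f (n ∸ k))     ≈⟨ sumTo-head n _ ⟩
    r * f n + sumTo n (λ k → 0# * f (n ∸ suc k))      ≈⟨ +-cong refl (sumTo-zero n (λ k _ → zeroˡ _)) ⟩
    r * f n + 0#                                      ≈⟨ +-identityʳ _ ⟩
    r * f n                                           ∎

  constS-+ : ∀ r s → constS (r + s) ≋ addS (constS r) (constS s)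
  constS-+ r s zero    = refl
  constS-+ r s (suc n) = sym (+-identityˡ 0#)

  mulS-identityˡ : ∀ f → mulS oneS f ≋ f
  mulS-identityˡ f n = trans (constS-mulS 1# f n) (*-identityˡ _)

  mulS-zeroˡ : ∀ f → mulS zeroS f ≋ zeroS
  mulS-zeroˡ f n = sumTo-zero (suc n) (λ k _ → zeroˡ _)

  mulS-assoc : ∀ f g h → mulS (mulS f g) h ≋ mulS f (mulS g h)
  mulS-assoc f g h n = begin
    sumTo (suc n) (λ k → sumTo (suc k) (λ i → f i * g (k ∸ i)) * h (n ∸ k))
      ≈⟨ sumTo-cong (suc n) (λ k → sym (sumTo-*ʳ (suc k) _ _)) ⟩
    sumTo (suc n) (λ k → sumTo (suc k) (λ i → (f i * g (k ∸ i)) * h (n ∸ k)))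
      ≈⟨ sumTo-triangle n _ ⟩
    sumTo (suc n) (λ i → sumTo (suc (n ∸ i)) (λ j → (f i * g ((i ℕ.+ j) ∸ i)) * h (n ∸ (i ℕ.+ j))))
      ≈⟨ sumTo-cong (suc n) (λ i → trans (sumTo-cong (suc (n ∸ i)) (λ j → reindex i j)) (sumTo-*ˡ (suc (n ∸ i)) _ _)) ⟩
    sumTo (suc n) (λ i → f i * sumTo (suc (n ∸ i)) (λ j → g j * h ((n ∸ i) ∸ j)))
      ∎
    where
    reindex : ∀ i j → (f i * g ((i ℕ.+ j) ∸ i)) * h (n ∸ (i ℕ.+ j)) ≈ f i * (g j * h ((n ∸ i) ∸ j))
    reindex i j = trans (*-assoc _ _ _) (*-cong refl (*-cong (reflexive (≡.cong g (ℕₚ.m+n∸m≡n i j)))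
                                                             (reflexive (≡.cong h (≡.sym (ℕₚ.∸-+-assoc n i j))))))

  seriesSemiring : CommutativeSemiring c ℓ
  seriesSemiring = record
    { _≈_ = _≋_ ; _+_ = addS ; _*_ = mulS ; 0# = zeroS ; 1# = oneS
    ; isCommutativeSemiring = IsCommutativeSemiringˡ.isCommutativeSemiring (record
      { +-isCommutativeMonoid = record
        { isMonoid = record
          { isSemigroup = record
            { isMagma = record { isEquivalence = Setoid.isEquivalence seriesSetoid ; ∙-cong = addS-cong }
            ; assoc   = λ f g h n → +-assoc _ _ _ }
          ; identity = (λ f n → +-identityˡ _) , (λ f n → +-identityʳ _) }
        ; comm = λ f g n → +-comm _ _ }
      ; *-isCommutativeMonoid = record
        { isMonoid = record
          { isSemigroup = record
            { isMagma = record { isEquivalence = Setoid.isEquivalence seriesSetoid ; ∙-cong = mulS-cong }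
            ; assoc   = mulS-assoc }
          ; identity = mulS-identityˡ , λ f → ≋-trans (mulS-comm f oneS) (mulS-identityˡ f) }
        ; comm = mulS-comm }
      ; distribʳ = λ h f g → ≋-trans (mulS-comm (addS f g) h)
                               (≋-trans (mulS-distribˡ h f g) (addS-cong (mulS-comm h f) (mulS-comm h g)))
      ; zeroˡ = mulS-zeroˡ })
    }

  module ≋ = Relation.Binary.Reasoning.Setoid seriesSetoid
  open Algebra.Solver.Ring.NaturalCoefficients.Default seriesSemiring
    using () renaming (solve to solveS; _:+_ to _⊕_; _:*_ to _⊛_; _:=_ to _≐_; con to conS)

  derivS-cong : ∀ {f g} → f ≋ g → derivS f ≋ derivS g
  derivS-cong e n = *-cong refl (e (suc n))

  derivS-constS : ∀ r → derivS (constS r) ≋ zeroS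
  derivS-constS r n = zeroʳ _

  derivS-mulS : ∀ f g → derivS (mulS f g) ≋ addS (mulS (derivS f) g) (mulS f (derivS g))
  derivS-mulS f g n = begin
    natC (suc n) * sumTo (suc (suc n)) (λ k → f k * g (suc n ∸ k))
      ≈⟨ sumTo-*ˡ (suc (suc n)) _ _ ⟨
    sumTo (suc (suc n)) (λ k → natC (suc n) * (f k * g (suc n ∸ k)))
      ≈⟨ sumTo-cong-< (suc (suc n)) (λ k k≤ → trans (*-cong (natC-∸ (ℕₚ.≤-pred k≤)) refl) (distribʳ _ _ _)) ⟩
    sumTo (suc (suc n)) (λ k → natC k * (f k * g (suc n ∸ k)) + natC (suc n ∸ k) * (f k * g (suc n ∸ k)))
      ≈⟨ sumTo-+ (suc (suc n)) _ _ ⟩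
    sumTo (suc (suc n)) (λ k → natC k * (f k * g (suc n ∸ k)))
      + sumTo (suc (suc n)) (λ k → natC (suc n ∸ k) * (f k * g (suc n ∸ k)))
      ≈⟨ +-cong derivative-on-f derivative-on-g ⟩
    mulS (derivS f) g n + mulS f (derivS g) n
      ∎
    where
    derivative-on-f : sumTo (suc (suc n)) (λ k → natC k * (f k * g (suc n ∸ k))) ≈ mulS (derivS f) g n
    derivative-on-f = begin
      sumTo (suc (suc n)) (λ k → natC k * (f k * g (suc n ∸ k)))
        ≈⟨ sumTo-head (suc n) _ ⟩
      0# * (f 0 * g (suc n)) + sumTo (suc n) (λ k → natC (suc k) * (f (suc k) * g (n ∸ k)))
        ≈⟨ trans (+-cong (zeroˡ _) refl) (+-identityˡ _) ⟩
      sumTo (suc n) (λ k → natC (suc k) * (f (suc k) * g (n ∸ k)))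
        ≈⟨ sumTo-cong (suc n) (λ k → sym (*-assoc _ _ _)) ⟩
      mulS (derivS f) g n
        ∎
    derivative-on-g : sumTo (suc (suc n)) (λ k → natC (suc n ∸ k) * (f k * g (suc n ∸ k))) ≈ mulS f (derivS g) n
    derivative-on-g = begin
      sumTo (suc n) (λ k → natC (suc n ∸ k) * (f k * g (suc n ∸ k))) + natC (n ∸ n) * (f (suc n) * g (n ∸ n))
        ≈⟨ +-cong refl (trans (*-cong (reflexive (≡.cong natC (ℕₚ.n∸n≡0 n))) refl) (zeroˡ _)) ⟩
      sumTo (suc n) (λ k → natC (suc n ∸ k) * (f k * g (suc n ∸ k))) + 0#
        ≈⟨ +-identityʳ _ ⟩
      sumTo (suc n) (λ k → natC (suc n ∸ k) * (f k * g (suc n ∸ k)))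
        ≈⟨ sumTo-cong-< (suc n) (λ k k≤n → trans
             (reflexive (≡.cong (λ m → natC m * (f k * g m)) (ℕₚ.+-∸-assoc 1 (ℕₚ.≤-pred k≤n))))
             (x∙yz≈y∙xz _ _ _)) ⟩
      mulS f (derivS g) n
        ∎

  derivS-constS-mulS : ∀ r f → derivS (mulS (constS r) f) ≋ mulS (constS r) (derivS f)
  derivS-constS-mulS r f = ≋.begin
    derivS (mulS (constS r) f)                                          ≋.≈⟨ derivS-mulS (constS r) f ⟩
    addS (mulS (derivS (constS r)) f) (mulS (constS r) (derivS f))      ≋.≈⟨ addS-cong (mulS-congʳ f (derivS-constS r)) ≋-refl ⟩
    addS (mulS zeroS f) (mulS (constS r) (derivS f))
      ≋.≈⟨ solveS 2 (λ f d → conS 0 ⊛ f ⊕ d ≐ d) ≋-refl f (mulS (constS r) (derivS f)) ⟩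
    mulS (constS r) (derivS f)                                          ≋.∎

  VanishesBelow : Series → ℕ → Set ℓ
  VanishesBelow f k = ∀ i → i < k → f i ≈ 0#

  mulS-vanishesBelow : ∀ {f g} k m → VanishesBelow f k → VanishesBelow g m → VanishesBelow (mulS f g) (k ℕ.+ m)
  mulS-vanishesBelow {f} {g} k m f₀ g₀ n n<k+m = sumTo-zero (suc n) term
    where
    term : ∀ i → i < suc n → f i * g (n ∸ i) ≈ 0#
    term i i≤n with i ℕ.<? k
    ... | yes i<k = trans (*-cong (f₀ i i<k) refl) (zeroˡ _)
    ... | no  i≮k = trans (*-cong refl (g₀ (n ∸ i) n∸i<m)) (zeroʳ _)
      where
      n∸i<m : n ∸ i < m
      n∸i<m = ℕₚ.+-cancelʳ-< i (n ∸ i) m (≡.subst (ℕ._< m ℕ.+ i) (≡.sym (ℕₚ.m∸n+n≡m (ℕₚ.≤-pred i≤n)))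
                (ℕₚ.<-≤-trans n<k+m (≡.subst (k ℕ.+ m ≤_) (ℕₚ.+-comm i m) (ℕₚ.+-monoˡ-≤ m (ℕₚ.≮⇒≥ i≮k)))))

  mulS-vanishesBelowˡ : ∀ {f} g k → VanishesBelow f k → VanishesBelow (mulS f g) k
  mulS-vanishesBelowˡ {f} g k f₀ =
    ≡.subst (VanishesBelow (mulS f g)) (ℕₚ.+-identityʳ k) (mulS-vanishesBelow {g = g} k 0 f₀ (λ _ ()))

  powS-zero : ∀ H → powS H 0 ≋ oneS
  powS-zero H zero    = refl
  powS-zero H (suc n) = refl

  powS-vanishesBelow : ∀ H → H 0 ≈ 0# → ∀ k → VanishesBelow (powS H k) k
  powS-vanishesBelow H H₀ zero    i ()
  powS-vanishesBelow H H₀ (suc k) =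
    mulS-vanishesBelow 1 k (λ { zero _ → H₀ ; (suc i) (s≤s ()) }) (powS-vanishesBelow H H₀ k)

  derivS-powS : ∀ H k → derivS (powS H (suc k)) ≋ mulS (constS (natC (suc k))) (mulS (powS H k) (derivS H))
  derivS-powS H zero = ≋.begin
    derivS (mulS H (powS H 0))                           ≋.≈⟨ derivS-cong (mulS-congˡ H (powS-zero H)) ⟩
    derivS (mulS H oneS)                                 ≋.≈⟨ derivS-cong (solveS 1 (λ h → h ⊛ conS 1 ≐ h) ≋-refl H) ⟩
    derivS H                                             ≋.≈⟨ solveS 1 (λ d → d ≐ conS 1 ⊛ (conS 1 ⊛ d)) ≋-refl (derivS H) ⟩
    mulS oneS (mulS oneS (derivS H))
      ≋.≈⟨ mulS-cong (constS-cong (sym (+-identityʳ 1#))) (mulS-congʳ (derivS H) (≋-sym (powS-zero H))) ⟩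
    mulS (constS (natC 1)) (mulS (powS H 0) (derivS H))  ≋.∎
  derivS-powS H (suc k) = ≋.begin
    derivS (mulS H (powS H (suc k)))
      ≋.≈⟨ derivS-mulS H (powS H (suc k)) ⟩
    addS (mulS (derivS H) (powS H (suc k))) (mulS H (derivS (powS H (suc k))))
      ≋.≈⟨ addS-cong ≋-refl (mulS-cong ≋-refl (derivS-powS H k)) ⟩
    addS (mulS (derivS H) (mulS H (powS H k))) (mulS H (mulS (constS (natC (suc k))) (mulS (powS H k) (derivS H))))
      ≋.≈⟨ solveS 4 (λ h p d c → d ⊛ (h ⊛ p) ⊕ h ⊛ (c ⊛ (p ⊛ d)) ≐ (conS 1 ⊕ c) ⊛ ((h ⊛ p) ⊛ d))
                   ≋-refl H (powS H k) (derivS H) (constS (natC (suc k))) ⟩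
    mulS (addS oneS (constS (natC (suc k)))) (mulS (mulS H (powS H k)) (derivS H))
      ≋.≈⟨ mulS-congʳ (mulS (powS H (suc k)) (derivS H)) (≋-sym (constS-+ 1# (natC (suc k)))) ⟩
    mulS (constS (natC (suc (suc k)))) (mulS (powS H (suc k)) (derivS H))
      ≋.∎

  pairP : Poly → (ℕ → Carrier) → Carrier
  pairP []      g = 0#
  pairP (b ∷ p) g = b * g 0 + pairP p (g ∘ suc)

  pairP-+ : ∀ p g h → pairP p (λ k → g k + h k) ≈ pairP p g + pairP p h
  pairP-+ []      g h = sym (+-identityˡ 0#)
  pairP-+ (b ∷ p) g h = trans (+-cong (distribˡ _ _ _) (pairP-+ p (g ∘ suc) (h ∘ suc)))
    (+-interchange _ _ _ _)

  pairP-*ˡ : ∀ p r g → pairP p (λ k → r * g k) ≈ r * pairP p g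
  pairP-*ˡ []      r g = sym (zeroʳ r)
  pairP-*ˡ (b ∷ p) r g = trans (+-cong (x∙yz≈y∙xz _ _ _) (pairP-*ˡ p r (g ∘ suc)))
    (sym (distribˡ _ _ _))

  powers : Carrier → ℕ → Carrier
  powers y zero    = 1#
  powers y (suc k) = y * powers y k

  evalP-pairP : ∀ p y → evalP p y ≈ pairP p (powers y)
  evalP-pairP []      y = refl
  evalP-pairP (b ∷ p) y = +-cong (sym (*-identityʳ _)) (trans (*-cong refl (evalP-pairP p y)) (sym (pairP-*ˡ p y (powers y))))

  Lfrom-addP : ∀ a i p q → Lfrom a i (addP p q) ≈ Lfrom a i p + Lfrom a i q
  Lfrom-addP a i []      q       = sym (+-identityˡ _)
  Lfrom-addP a i (b ∷ p) []      = sym (+-identityʳ _)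
  Lfrom-addP a i (b ∷ p) (d ∷ q) = trans (+-cong (distribʳ _ _ _) (Lfrom-addP a (suc i) p q))
    (+-interchange _ _ _ _)

  Lfrom-scaleP : ∀ a i r p → Lfrom a i (scaleP r p) ≈ r * Lfrom a i p
  Lfrom-scaleP a i r []      = sym (zeroʳ r)
  Lfrom-scaleP a i r (b ∷ p) = trans (+-cong (*-assoc _ _ _) (Lfrom-scaleP a (suc i) r p)) (sym (distribˡ _ _ _))

  Lfrom-suc : ∀ a i p → Lfrom a (suc i) p ≡ Lfrom (a ∘ suc) i p
  Lfrom-suc a i []      = ≡.refl
  Lfrom-suc a i (b ∷ p) = ≡.cong (b * a (suc i) +_) (Lfrom-suc a (suc i) p)

  L-mulP-uPlus : ∀ a x q → L a (mulP (uPlus x) q) ≈ L (a ∘ suc) q + x * L a q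
  L-mulP-uPlus a x q = begin
    Lfrom a 0 (addP (scaleP x q) (0# ∷ addP (scaleP 1# q) (0# ∷ [])))
      ≈⟨ Lfrom-addP a 0 (scaleP x q) (0# ∷ addP (scaleP 1# q) (0# ∷ [])) ⟩
    Lfrom a 0 (scaleP x q) + (0# * a 0 + Lfrom a 1 (addP (scaleP 1# q) (0# ∷ [])))
      ≈⟨ +-cong (Lfrom-scaleP a 0 x q) (+-cong (zeroˡ _) (Lfrom-addP a 1 (scaleP 1# q) (0# ∷ []))) ⟩
    x * L a q + (0# + (Lfrom a 1 (scaleP 1# q) + (0# * a 1 + 0#)))
      ≈⟨ +-cong refl (+-cong refl (+-cong (trans (Lfrom-scaleP a 1 1# q) (*-cong refl (reflexive (Lfrom-suc a 0 q))))
                                          (+-cong (zeroˡ _) refl))) ⟩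
    x * L a q + (0# + (1# * L (a ∘ suc) q + (0# + 0#)))
      ≈⟨ solve 2 (λ a b → a :+ (con 0 :+ (con 1 :* b :+ (con 0 :+ con 0))) := b :+ a) refl _ _ ⟩
    L (a ∘ suc) q + x * L a q
      ∎

  -- moment a x j = L a ((u + x) ^ j)
  moment : (ℕ → Carrier) → Carrier → ℕ → Carrier
  moment a x zero    = a 0
  moment a x (suc j) = moment (a ∘ suc) x j + x * moment a x j

  L-compP-uPlus : ∀ a x p → L a (compP p (uPlus x)) ≈ pairP p (moment a x)
  L-mulP-uPlus-compP : ∀ a x p → L a (mulP (uPlus x) (compP p (uPlus x))) ≈ pairP p (moment a x ∘ suc)

  L-compP-uPlus a x []      = refl
  L-compP-uPlus a x (b ∷ p) = begin
    L a (addP (b ∷ []) (mulP (uPlus x) (compP p (uPlus x))))      ≈⟨ Lfrom-addP a 0 (b ∷ []) (mulP (uPlus x) (compP p (uPlus x))) ⟩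
    (b * a 0 + 0#) + L a (mulP (uPlus x) (compP p (uPlus x)))     ≈⟨ +-cong (+-identityʳ _) (L-mulP-uPlus-compP a x p) ⟩
    b * a 0 + pairP p (moment a x ∘ suc)                          ∎

  L-mulP-uPlus-compP a x p = begin
    L a (mulP (uPlus x) C)
      ≈⟨ L-mulP-uPlus a x C ⟩
    L (a ∘ suc) C + x * L a C
      ≈⟨ +-cong (L-compP-uPlus (a ∘ suc) x p) (*-cong refl (L-compP-uPlus a x p)) ⟩
    pairP p (moment (a ∘ suc) x) + x * pairP p (moment a x)
      ≈⟨ +-cong refl (pairP-*ˡ p x (moment a x)) ⟨
    pairP p (moment (a ∘ suc) x) + pairP p (λ k → x * moment a x k)
      ≈⟨ pairP-+ p _ _ ⟨
    pairP p (moment a x ∘ suc)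
      ∎
    where
    C = compP p (uPlus x)

  module ℚ-Algebra (natC-inv : ∀ n → natC (suc n) * inv n ≈ 1#) where

    inv-natC : ∀ n → inv n * natC (suc n) ≈ 1#
    inv-natC n = trans (*-comm _ _) (natC-inv n)

    natC-invFact : ∀ k → natC (suc k) * invFact (suc k) ≈ invFact k
    natC-invFact k = begin
      natC (suc k) * (inv k * invFact k) ≈⟨ *-assoc _ _ _ ⟨
      (natC (suc k) * inv k) * invFact k ≈⟨ *-cong (natC-inv k) refl ⟩
      1# * invFact k                     ≈⟨ *-identityˡ _ ⟩
      invFact k                          ∎

    cancel-natC : ∀ k r → inv k * (natC (suc k) * r) ≈ r
    cancel-natC k r = trans (sym (*-assoc _ _ _)) (trans (*-cong (inv-natC k) refl) (*-identityˡ r))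

    derivS-expS : ∀ H → H 0 ≈ 0# → derivS (expS H) ≋ mulS (expS H) (derivS H)
    derivS-expS H H₀ n = trans differentiated (sym multiplied)
      where
      X : ℕ → Series
      X k = mulS (powS H k) (derivS H)
      differentiated : derivS (expS H) n ≈ sumTo (suc n) (λ k → invFact k * X k n)
      differentiated = begin
        natC (suc n) * sumTo (suc (suc n)) (λ k → invFact k * powS H k (suc n))
          ≈⟨ sumTo-*ˡ (suc (suc n)) _ _ ⟨
        sumTo (suc (suc n)) (λ k → natC (suc n) * (invFact k * powS H k (suc n)))
          ≈⟨ sumTo-cong (suc (suc n)) (λ k → x∙yz≈y∙xz _ _ _) ⟩
        sumTo (suc (suc n)) (λ k → invFact k * derivS (powS H k) n)
          ≈⟨ sumTo-head (suc n) _ ⟩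
        1# * (natC (suc n) * 0#) + sumTo (suc n) (λ k → invFact (suc k) * derivS (powS H (suc k)) n)
          ≈⟨ trans (+-cong (trans (*-cong refl (zeroʳ _)) (zeroʳ _)) refl) (+-identityˡ _) ⟩
        sumTo (suc n) (λ k → invFact (suc k) * derivS (powS H (suc k)) n)
          ≈⟨ sumTo-cong (suc n) (λ k → begin
               invFact (suc k) * derivS (powS H (suc k)) n
                 ≈⟨ *-cong refl (trans (derivS-powS H k n) (constS-mulS (natC (suc k)) (X k) n)) ⟩
               invFact (suc k) * (natC (suc k) * X k n)
                 ≈⟨ x∙yz≈yx∙z _ _ _ ⟩
               (natC (suc k) * invFact (suc k)) * X k n
                 ≈⟨ *-cong (natC-invFact k) refl ⟩
               invFact k * X k n
                 ∎) ⟩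
        sumTo (suc n) (λ k → invFact k * X k n)
          ∎
      truncate : ∀ {i} → i < suc n → expS H i ≈ sumTo (suc n) (λ k → invFact k * powS H k i)
      truncate {i} i≤n = sym (sumTo-extend (suc i) (suc n) i≤n
        (λ k i<k → trans (*-cong refl (powS-vanishesBelow H H₀ k i i<k)) (zeroʳ _)))
      multiplied : mulS (expS H) (derivS H) n ≈ sumTo (suc n) (λ k → invFact k * X k n)
      multiplied = begin
        sumTo (suc n) (λ i → expS H i * derivS H (n ∸ i))
          ≈⟨ sumTo-cong-< (suc n) (λ i i≤n → trans (*-cong (truncate i≤n) refl) (sym (sumTo-*ʳ (suc n) _ _))) ⟩
        sumTo (suc n) (λ i → sumTo (suc n) (λ k → (invFact k * powS H k i) * derivS H (n ∸ i)))
          ≈⟨ sumTo-swap (suc n) (suc n) _ ⟩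
        sumTo (suc n) (λ k → sumTo (suc n) (λ i → (invFact k * powS H k i) * derivS H (n ∸ i)))
          ≈⟨ sumTo-cong (suc n) (λ k → trans (sumTo-cong (suc n) (λ i → *-assoc _ _ _)) (sumTo-*ˡ (suc n) _ _)) ⟩
        sumTo (suc n) (λ k → invFact k * X k n)
          ∎

    -- Σₖ (-1)ᵏ Gᵏ G′ = G′/(1+G), truncated at k ≤ n, which is harmless since Gᵏ G′ vanishes below degree k.
    derivLogOnePlus : Series → Series
    derivLogOnePlus G n = sumTo (suc n) (λ k → signC k * mulS (powS G k) (derivS G) n)

    derivS-logS : ∀ F → derivS (logS F) ≋ derivLogOnePlus (minusOne F)
    derivS-logS F n = begin
      natC (suc n) * sumTo (suc n) (λ k → signC k * (inv k * powS G (suc k) (suc n)))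
        ≈⟨ sumTo-*ˡ (suc n) _ _ ⟨
      sumTo (suc n) (λ k → natC (suc n) * (signC k * (inv k * powS G (suc k) (suc n))))
        ≈⟨ sumTo-cong (suc n) (λ k → solve 4 (λ a b d e → a :* (b :* (d :* e)) := b :* (d :* (a :* e))) refl _ _ _ _) ⟩
      sumTo (suc n) (λ k → signC k * (inv k * derivS (powS G (suc k)) n))
        ≈⟨ sumTo-cong (suc n) (λ k → *-cong refl (begin
             inv k * derivS (powS G (suc k)) n
               ≈⟨ *-cong refl (trans (derivS-powS G k n) (constS-mulS (natC (suc k)) (mulS (powS G k) (derivS G)) n)) ⟩
             inv k * (natC (suc k) * mulS (powS G k) (derivS G) n)
               ≈⟨ cancel-natC k _ ⟩
             mulS (powS G k) (derivS G) n
               ∎)) ⟩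
      derivLogOnePlus G n
        ∎
      where
      G = minusOne F

    onePlus-mulS-derivLogOnePlus : ∀ G → G 0 ≈ 0# → mulS (addS oneS G) (derivLogOnePlus G) ≋ derivS G
    onePlus-mulS-derivLogOnePlus G G₀ n = begin
      mulS (addS oneS G) Y n                           ≈⟨ solveS 2 (λ g y → (conS 1 ⊕ g) ⊛ y ≐ y ⊕ g ⊛ y) ≋-refl G Y n ⟩
      Y n + mulS G Y n                                 ≈⟨ +-cong refl shifted ⟩
      sumTo (suc n) (term n) + sumTo (suc n) (λ k → - term n (suc k)) ≈⟨ sumTo-+ (suc n) _ _ ⟨
      sumTo (suc n) (λ k → term n k - term n (suc k))   ≈⟨ sumTo-telescope (suc n) (term n) ⟩
      term n 0 - term n (suc n)                        ≈⟨ +-cong refl (-‿cong (term-vanishes (suc n) ℕₚ.≤-refl)) ⟩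
      term n 0 - 0#                                    ≈⟨ trans (+-cong refl -0#≈0#) (+-identityʳ _) ⟩
      1# * mulS (powS G 0) (derivS G) n                ≈⟨ trans (*-identityˡ _) (mulS-congʳ (derivS G) (powS-zero G) n) ⟩
      mulS oneS (derivS G) n                           ≈⟨ mulS-identityˡ (derivS G) n ⟩
      derivS G n                                       ∎
      where
      Y = derivLogOnePlus G
      X : ℕ → Series
      X k = mulS (powS G k) (derivS G)
      term : ℕ → ℕ → Carrier
      term n k = signC k * X k n
      term-vanishes : ∀ {m} k → m < k → term m k ≈ 0#
      term-vanishes {m} k m<k =
        trans (*-cong refl (mulS-vanishesBelowˡ (derivS G) k (powS-vanishesBelow G G₀ k) m m<k)) (zeroʳ _)
      truncate : ∀ {m} → m ≤ n → Y m ≈ sumTo (suc n) (term m)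
      truncate m≤n = sym (sumTo-extend _ (suc n) (s≤s m≤n) (λ k m<k → term-vanishes k m<k))
      flip-sign : ∀ k → signC k * X (suc k) n ≈ - term n (suc k)
      flip-sign k = trans (*-cong (sym (-‿involutive _)) refl) (sym (-‿distribˡ-* _ _))
      shifted : mulS G Y n ≈ sumTo (suc n) (λ k → - term n (suc k))
      shifted = begin
        sumTo (suc n) (λ i → G i * Y (n ∸ i))
          ≈⟨ sumTo-cong (suc n) (λ i → trans (*-cong refl (truncate (ℕₚ.m∸n≤m n i))) (sym (sumTo-*ˡ (suc n) _ _))) ⟩
        sumTo (suc n) (λ i → sumTo (suc n) (λ k → G i * term (n ∸ i) k))
          ≈⟨ sumTo-swap (suc n) (suc n) _ ⟩
        sumTo (suc n) (λ k → sumTo (suc n) (λ i → G i * term (n ∸ i) k))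
          ≈⟨ sumTo-cong (suc n) (λ k → trans (sumTo-cong (suc n) (λ i → x∙yz≈y∙xz _ _ _))
                                             (sumTo-*ˡ (suc n) _ _)) ⟩
        sumTo (suc n) (λ k → signC k * mulS G (X k) n)
          ≈⟨ sumTo-cong (suc n) (λ k → trans (*-cong refl (sym (mulS-assoc G (powS G k) (derivS G) n))) (flip-sign k)) ⟩
        sumTo (suc n) (λ k → - term n (suc k))
          ∎

    minusOne-split : ∀ F → F 0 ≈ 1# → F ≋ addS oneS (minusOne F)
    minusOne-split F F₀ zero    = trans F₀ (sym (+-identityʳ _))
    minusOne-split F F₀ (suc n) = sym (+-identityˡ _)

    mulS-derivS-logS : ∀ F → F 0 ≈ 1# → mulS F (derivS (logS F)) ≋ derivS F
    mulS-derivS-logS F F₀ = ≋.begin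
      mulS F (derivS (logS F))                       ≋.≈⟨ mulS-cong (minusOne-split F F₀) (derivS-logS F) ⟩
      mulS (addS oneS G) (derivLogOnePlus G)          ≋.≈⟨ onePlus-mulS-derivLogOnePlus G refl ⟩
      derivS G                                       ≋.∎
      where
      G = minusOne F

    SolvesPowerODE : Series → Carrier → Series → Set ℓ
    SolvesPowerODE F r G = mulS F (derivS G) ≋ mulS (constS r) (mulS G (derivS F))

    powα-solvesPowerODE : ∀ F β → F 0 ≈ 1# → SolvesPowerODE F β (powα F β)
    powα-solvesPowerODE F β F₀ = ≋.begin
      mulS F (derivS (powα F β))                         ≋.≈⟨ mulS-congˡ F (derivS-expS H (zeroʳ β)) ⟩
      mulS F (mulS (powα F β) (derivS H))                ≋.≈⟨ mulS-congˡ F (mulS-congˡ (powα F β) derivS-H) ⟩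
      mulS F (mulS (powα F β) (mulS (constS β) (derivS (logS F))))
        ≋.≈⟨ solveS 4 (λ f p b l → f ⊛ (p ⊛ (b ⊛ l)) ≐ b ⊛ (p ⊛ (f ⊛ l))) ≋-refl F (powα F β) (constS β) (derivS (logS F)) ⟩
      mulS (constS β) (mulS (powα F β) (mulS F (derivS (logS F))))
        ≋.≈⟨ mulS-congˡ (constS β) (mulS-congˡ (powα F β) (mulS-derivS-logS F F₀)) ⟩
      mulS (constS β) (mulS (powα F β) (derivS F))       ≋.∎
      where
      H = scaleS β (logS F)
      derivS-H : derivS H ≋ mulS (constS β) (derivS (logS F))
      derivS-H = ≋-trans (derivS-cong (≋-sym (constS-mulS β (logS F)))) (derivS-constS-mulS β (logS F))

    mulS-solvesPowerODE : ∀ {F r G} → SolvesPowerODE F r G → SolvesPowerODE F (r + 1#) (mulS F G)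
    mulS-solvesPowerODE {F} {r} {G} ode = ≋.begin
      mulS F (derivS (mulS F G))
        ≋.≈⟨ mulS-congˡ F (derivS-mulS F G) ⟩
      mulS F (addS (mulS (derivS F) G) (mulS F (derivS G)))
        ≋.≈⟨ solveS 4 (λ f df g dg → f ⊛ (df ⊛ g ⊕ f ⊛ dg) ≐ f ⊛ (df ⊛ g) ⊕ f ⊛ (f ⊛ dg)) ≋-refl F (derivS F) G (derivS G) ⟩
      addS (mulS F (mulS (derivS F) G)) (mulS F (mulS F (derivS G)))
        ≋.≈⟨ addS-congˡ (mulS F (mulS (derivS F) G)) (mulS-congˡ F ode) ⟩
      addS (mulS F (mulS (derivS F) G)) (mulS F (mulS (constS r) (mulS G (derivS F))))
        ≋.≈⟨ solveS 4 (λ f df g c → f ⊛ (df ⊛ g) ⊕ f ⊛ (c ⊛ (g ⊛ df)) ≐ (c ⊕ conS 1) ⊛ ((f ⊛ g) ⊛ df))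
                     ≋-refl F (derivS F) G (constS r) ⟩
      mulS (addS (constS r) oneS) (mulS (mulS F G) (derivS F))
        ≋.≈⟨ mulS-congʳ (mulS (mulS F G) (derivS F)) (≋-sym (constS-+ r 1#)) ⟩
      mulS (constS (r + 1#)) (mulS (mulS F G) (derivS F))
        ≋.∎

    powerODE-unique : ∀ {F r G H} → F 0 ≈ 1# → SolvesPowerODE F r G → SolvesPowerODE F r H → G 0 ≈ H 0 → G ≋ H
    powerODE-unique {F} {r} {G} {H} F₀ odeG odeH G₀≈H₀ n = agree n n ℕₚ.≤-refl
      where
      next : ∀ n → (∀ m → m ≤ n → G m ≈ H m) → G (suc n) ≈ H (suc n)
      next n IH = begin
        G (suc n)           ≈⟨ cancel-natC n _ ⟨
        inv n * derivS G n  ≈⟨ *-cong refl derivS-agree ⟩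
        inv n * derivS H n  ≈⟨ cancel-natC n _ ⟩
        H (suc n)           ∎
        where
        lower : ∀ K → Carrier
        lower K = sumTo n (λ k → derivS K k * F (n ∸ k))
        split : ∀ K → mulS F (derivS K) n ≈ lower K + derivS K n
        split K = trans (mulS-comm F (derivS K) n)
          (+-cong refl (trans (*-cong refl (trans (reflexive (≡.cong F (ℕₚ.n∸n≡0 n))) F₀)) (*-identityʳ _)))
        lower-agree : lower G ≈ lower H
        lower-agree = sumTo-cong-< n (λ k k<n → *-cong (*-cong refl (IH (suc k) k<n)) refl)
        rhs-agree : mulS G (derivS F) n ≈ mulS H (derivS F) n
        rhs-agree = sumTo-cong-< (suc n) (λ i i≤n → *-cong (IH i (ℕₚ.≤-pred i≤n)) refl)
        derivS-agree : derivS G n ≈ derivS H n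
        derivS-agree = +-cancelˡ (lower H) _ _ (begin
          lower H + derivS G n                    ≈⟨ +-cong lower-agree refl ⟨
          lower G + derivS G n                    ≈⟨ split G ⟨
          mulS F (derivS G) n                     ≈⟨ trans (odeG n) (constS-mulS r (mulS G (derivS F)) n) ⟩
          r * mulS G (derivS F) n                 ≈⟨ *-cong refl rhs-agree ⟩
          r * mulS H (derivS F) n                 ≈⟨ trans (odeH n) (constS-mulS r (mulS H (derivS F)) n) ⟨
          mulS F (derivS H) n                     ≈⟨ split H ⟩
          lower H + derivS H n                    ∎)
      agree : ∀ n m → m ≤ n → G m ≈ H m
      agree zero    _ z≤n = G₀≈H₀
      agree (suc n) m m≤ with ℕₚ.m≤n⇒m<n∨m≡n m≤
      ... | inj₁ (s≤s m≤n) = agree n m m≤n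
      ... | inj₂ ≡.refl     = next n (agree n)

    powα-zero : ∀ F β → powα F β 0 ≈ 1#
    powα-zero F β = trans (+-identityˡ _) (*-identityˡ _)

    powα-+1 : ∀ F β → F 0 ≈ 1# → powα F (β + 1#) ≋ mulS F (powα F β)
    powα-+1 F β F₀ = powerODE-unique F₀ (powα-solvesPowerODE F (β + 1#) F₀)
      (mulS-solvesPowerODE (powα-solvesPowerODE F β F₀))
      (trans (powα-zero F (β + 1#)) (sym (trans (+-identityˡ _) (trans (*-cong F₀ (powα-zero F β)) (*-identityˡ _)))))

    egf : (ℕ → Carrier) → Series
    egf g k = g k * invFact k

    derivS-egf : ∀ g → derivS (egf g) ≋ egf (g ∘ suc)
    derivS-egf g k = trans (x∙yz≈y∙xz _ _ _) (*-cong refl (natC-invFact k))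

    derivS-egf-powers : ∀ x → derivS (egf (powers x)) ≋ mulS (constS x) (egf (powers x))
    derivS-egf-powers x k = trans (derivS-egf (powers x) k) (trans (*-assoc _ _ _) (sym (constS-mulS x (egf (powers x)) k)))

    derivS-egf-mulS-powers : ∀ a x → derivS (mulS (egf a) (egf (powers x)))
                                     ≋ addS (mulS (egf (a ∘ suc)) (egf (powers x))) (mulS (constS x) (mulS (egf a) (egf (powers x))))
    derivS-egf-mulS-powers a x = ≋.begin
      derivS (mulS (egf a) E)
        ≋.≈⟨ derivS-mulS (egf a) E ⟩
      addS (mulS (derivS (egf a)) E) (mulS (egf a) (derivS E))
        ≋.≈⟨ addS-cong (mulS-congʳ E (derivS-egf a)) (mulS-congˡ (egf a) (derivS-egf-powers x)) ⟩
      addS (mulS (egf (a ∘ suc)) E) (mulS (egf a) (mulS (constS x) E))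
        ≋.≈⟨ addS-congˡ (mulS (egf (a ∘ suc)) E) (solveS 3 (λ a c e → a ⊛ (c ⊛ e) ≐ c ⊛ (a ⊛ e)) ≋-refl (egf a) (constS x) E) ⟩
      addS (mulS (egf (a ∘ suc)) E) (mulS (constS x) (mulS (egf a) E))
        ≋.∎
      where
      E = egf (powers x)

    egf-moment : ∀ a x → egf (moment a x) ≋ mulS (egf a) (egf (powers x))
    egf-moment a x zero    = solve 1 (λ b → b :* con 1 := con 0 :+ (b :* con 1) :* (con 1 :* con 1)) refl (a 0)
    egf-moment a x (suc j) = begin
      (moment (a ∘ suc) x j + x * moment a x j) * (inv j * invFact j)
        ≈⟨ solve 5 (λ t₁ y t₂ i f → (t₁ :+ y :* t₂) :* (i :* f) := i :* (t₁ :* f :+ y :* (t₂ :* f))) refl _ _ _ _ _ ⟩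
      inv j * (egf (moment (a ∘ suc) x) j + x * egf (moment a x) j)
        ≈⟨ *-cong refl (+-cong (egf-moment (a ∘ suc) x j) (*-cong refl (egf-moment a x j))) ⟩
      inv j * (mulS (egf (a ∘ suc)) E j + x * mulS (egf a) E j)
        ≈⟨ *-cong refl (sym (trans (derivS-egf-mulS-powers a x j) (+-cong refl (constS-mulS x (mulS (egf a) E) j)))) ⟩
      inv j * (natC (suc j) * mulS (egf a) E (suc j))
        ≈⟨ cancel-natC j _ ⟩
      mulS (egf a) E (suc j)
        ∎
      where
      E = egf (powers x)

    pairP-fpolyFrom : ∀ a β n j m g →
      pairP (fpolyFrom a β n j m) g ≈ sumTo m (λ k → natC (n !) * (invFact (j ℕ.+ k) * powα (genF a) β (n ∸ (j ℕ.+ k))) * g k)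
    pairP-fpolyFrom a β n j zero    g = refl
    pairP-fpolyFrom a β n j (suc m) g = begin
      coef j * g 0 + pairP (fpolyFrom a β n (suc j) m) (g ∘ suc)   ≈⟨ +-cong refl (pairP-fpolyFrom a β n (suc j) m (g ∘ suc)) ⟩
      coef j * g 0 + sumTo m (λ k → coef (suc j ℕ.+ k) * g (suc k))
        ≈⟨ +-cong (reflexive (≡.cong (λ i → coef i * g 0) (≡.sym (ℕₚ.+-identityʳ j))))
                  (sumTo-cong m (λ k → reflexive (≡.cong (λ i → coef i * g (suc k)) (≡.sym (ℕₚ.+-suc j k))))) ⟩
      coef (j ℕ.+ 0) * g 0 + sumTo m (λ k → coef (j ℕ.+ suc k) * g (suc k)) ≈⟨ sumTo-head m _ ⟨
      sumTo (suc m) (λ k → coef (j ℕ.+ k) * g k)                     ∎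
      where
      coef : ℕ → Carrier
      coef i = natC (n !) * (invFact i * powα (genF a) β (n ∸ i))

    pairP-fpoly : ∀ a β n g → pairP (fpoly a β n) g ≈ natC (n !) * mulS (egf g) (powα (genF a) β) n
    pairP-fpoly a β n g = begin
      pairP (fpoly a β n) g
        ≈⟨ pairP-fpolyFrom a β n 0 (suc n) g ⟩
      sumTo (suc n) (λ k → natC (n !) * (invFact k * powα (genF a) β (n ∸ k)) * g k)
        ≈⟨ sumTo-cong (suc n) (λ k → solve 4 (λ m f p y → (m :* (f :* p)) :* y := m :* ((y :* f) :* p)) refl _ _ _ _) ⟩
      sumTo (suc n) (λ k → natC (n !) * (egf g k * powα (genF a) β (n ∸ k)))
        ≈⟨ sumTo-*ˡ (suc n) _ _ ⟩
      natC (n !) * mulS (egf g) (powα (genF a) β) n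
        ∎

    evalP-fpoly : ∀ a γ m y → evalP (fpoly a γ m) y ≈ natC (m !) * mulS (egf (powers y)) (powα (genF a) γ) m
    evalP-fpoly a γ m y = trans (evalP-pairP (fpoly a γ m) y) (pairP-fpoly a γ m (powers y))

    genF-egf : ∀ a → a 0 ≈ 1# → genF a ≋ egf a
    genF-egf a a₀ zero    = sym (trans (*-identityʳ _) a₀)
    genF-egf a a₀ (suc k) = refl

    module UmbralSeries (a : ℕ → Carrier) (a₀ : a 0 ≈ 1#) (β x : Carrier) where
      private
        F = genF a
        P = powα F β
        Q = powα F (β + 1#)
        E = egf (powers x)

      egf-moment-genF : egf (moment a x) ≋ mulS F E
      egf-moment-genF = ≋-trans (egf-moment a x) (mulS-congʳ E (≋-sym (genF-egf a a₀)))

      egf-moment-mulS-powα : mulS (egf (moment a x)) P ≋ mulS E Q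
      egf-moment-mulS-powα = ≋.begin
        mulS (egf (moment a x)) P       ≋.≈⟨ mulS-congʳ P egf-moment-genF ⟩
        mulS (mulS F E) P               ≋.≈⟨ solveS 3 (λ f e p → (f ⊛ e) ⊛ p ≐ e ⊛ (f ⊛ p)) ≋-refl F E P ⟩
        mulS E (mulS F P)               ≋.≈⟨ mulS-congˡ E (powα-+1 F β refl) ⟨
        mulS E Q                        ≋.∎

      -- both sides equal (β + 1)(F′ + xF)E·P, using F·P′ = β P F′ and Q = F P
      derivS-egf-moment-mulS-powα :
        mulS (constS (β + 1#)) (mulS (derivS (egf (moment a x))) P)
        ≋ addS (derivS (mulS E Q)) (mulS (constS β) (mulS (constS x) (mulS E Q)))
      derivS-egf-moment-mulS-powα = ≋.begin
        mulS (constS (β + 1#)) (mulS (derivS (egf (moment a x))) P)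
          ≋.≈⟨ mulS-cong (constS-+ β 1#) (mulS-congʳ P (≋-trans (derivS-cong egf-moment-genF) (derivS-mulS F E))) ⟩
        mulS (addS cβ oneS) (mulS (addS (mulS DF E) (mulS F (derivS E))) P)
          ≋.≈⟨ mulS-congˡ (addS cβ oneS) (mulS-congʳ P (addS-congˡ (mulS DF E) (mulS-congˡ F (derivS-egf-powers x)))) ⟩
        mulS (addS cβ oneS) (mulS (addS (mulS DF E) (mulS F (mulS cx E))) P)
          ≋.≈⟨ solveS 6 (λ f df p e b c → (b ⊕ conS 1) ⊛ ((df ⊛ e ⊕ f ⊛ (c ⊛ e)) ⊛ p)
                           ≐ ((c ⊛ e) ⊛ (f ⊛ p) ⊕ e ⊛ (df ⊛ p ⊕ b ⊛ (p ⊛ df))) ⊕ b ⊛ (c ⊛ (e ⊛ (f ⊛ p))))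
                 ≋-refl F DF P E cβ cx ⟩
        addS (addS (mulS (mulS cx E) (mulS F P)) (mulS E (addS (mulS DF P) (mulS cβ (mulS P DF))))) (xβ (mulS E (mulS F P)))
          ≋.≈⟨ addS-congʳ (xβ (mulS E (mulS F P))) (addS-cong (mulS-congʳ (mulS F P) (derivS-egf-powers x))
                 (mulS-congˡ E (≋-trans (derivS-mulS F P) (addS-congˡ (mulS DF P) (powα-solvesPowerODE F β refl))))) ⟨
        addS (addS (mulS (derivS E) (mulS F P)) (mulS E (derivS (mulS F P)))) (xβ (mulS E (mulS F P)))
          ≋.≈⟨ addS-cong (≋-trans (≋-sym (derivS-mulS E (mulS F P))) (derivS-cong (mulS-congˡ E FP≋Q)))
                         (mulS-congˡ cβ (mulS-congˡ cx (mulS-congˡ E FP≋Q))) ⟩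
        addS (derivS (mulS E Q)) (xβ (mulS E Q))
          ≋.∎
        where
        cβ = constS β
        cx = constS x
        DF = derivS F
        xβ : Series → Series
        xβ g = mulS cβ (mulS cx g)
        FP≋Q : mulS F P ≋ Q
        FP≋Q = ≋-sym (powα-+1 F β refl)

      L-compP-fpoly : ∀ n → L a (compP (fpoly a β n) (uPlus x)) ≈ natC (n !) * mulS E Q n
      L-compP-fpoly n = begin
        L a (compP (fpoly a β n) (uPlus x))      ≈⟨ L-compP-uPlus a x (fpoly a β n) ⟩
        pairP (fpoly a β n) (moment a x)         ≈⟨ pairP-fpoly a β n (moment a x) ⟩
        natC (n !) * mulS (egf (moment a x)) P n ≈⟨ *-cong refl (egf-moment-mulS-powα n) ⟩
        natC (n !) * mulS E Q n                  ∎

      L-mulP-uPlus-compP-fpoly : ∀ n → (β + 1#) * L a (mulP (uPlus x) (compP (fpoly a β n) (uPlus x)))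
                                       ≈ natC (n !) * (derivS (mulS E Q) n + β * (x * mulS E Q n))
      L-mulP-uPlus-compP-fpoly n = begin
        (β + 1#) * L a (mulP (uPlus x) (compP (fpoly a β n) (uPlus x)))
          ≈⟨ *-cong refl (trans (L-mulP-uPlus-compP a x (fpoly a β n)) (pairP-fpoly a β n (moment a x ∘ suc))) ⟩
        (β + 1#) * (natC (n !) * mulS (egf (moment a x ∘ suc)) P n)
          ≈⟨ *-cong refl (*-cong refl (mulS-congʳ P (derivS-egf (moment a x)) n)) ⟨
        (β + 1#) * (natC (n !) * mulS D P n)
          ≈⟨ x∙yz≈y∙xz _ _ _ ⟩
        natC (n !) * ((β + 1#) * mulS D P n)
          ≈⟨ *-cong refl (trans (sym (constS-mulS (β + 1#) (mulS D P) n)) (derivS-egf-moment-mulS-powα n)) ⟩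
        natC (n !) * (derivS (mulS E Q) n + mulS (constS β) (mulS (constS x) (mulS E Q)) n)
          ≈⟨ *-cong refl (+-cong refl (trans (constS-mulS β (mulS (constS x) (mulS E Q)) n) (*-cong refl (constS-mulS x (mulS E Q) n)))) ⟩
        natC (n !) * (derivS (mulS E Q) n + β * (x * mulS E Q n))
          ∎
        where
        D = derivS (egf (moment a x))

lemma3 : {c ℓ : Level} (R : CommutativeRing c ℓ) (inv : ℕ → CommutativeRing.Carrier R) →
    (∀ n → CommutativeRing._≈_ R (CommutativeRing._*_ R (Umbral.natC R inv (suc n)) (inv n)) (CommutativeRing.1# R)) →
    let open CommutativeRing R
        open Umbral R inv
    in (a : ℕ → Carrier) → a 0 ≈ 1# →
       (α : Carrier) (n : ℕ) (x : Carrier) →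
       (L a (compP (fpoly a α n) (uPlus x)) ≈ evalP (fpoly a (α + 1#) n) x)
       × ((α + 1#) * L a (mulP (uPlus x) (compP (fpoly a α n) (uPlus x)))
           ≈ evalP (fpoly a (α + 1#) (suc n)) x + α * x * evalP (fpoly a (α + 1#) n) x)
lemma3 R inv natC-inv a a₀ α n x = shift , shift-uPlus
  where
  open CommutativeRing R
  open Umbral R inv
  open UmbralCalculus R inv
  open ℚ-Algebra natC-inv
  open UmbralSeries a a₀ α x
  open Relation.Binary.Reasoning.Setoid setoid
  open Algebra.Solver.Ring.NaturalCoefficients.Default commutativeSemiring
  N = natC (n !)
  EQ = mulS (egf (powers x)) (powα (genF a) (α + 1#))
  f = fpoly a (α + 1#)
  shift = begin
    L a (compP (fpoly a α n) (uPlus x))  ≈⟨ L-compP-fpoly n ⟩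
    N * EQ n                             ≈⟨ evalP-fpoly a (α + 1#) n x ⟨
    evalP (f n) x                        ∎
  shift-uPlus = begin
    (α + 1#) * L a (mulP (uPlus x) (compP (fpoly a α n) (uPlus x)))  ≈⟨ L-mulP-uPlus-compP-fpoly n ⟩
    N * (natC (suc n) * EQ (suc n) + α * (x * EQ n))
      ≈⟨ solve 6 (λ m s q₁ b y q₀ → m :* (s :* q₁ :+ b :* (y :* q₀)) := (s :* m) :* q₁ :+ b :* y :* (m :* q₀)) refl _ _ _ _ _ _ ⟩
    (natC (suc n) * N) * EQ (suc n) + α * x * (N * EQ n)
      ≈⟨ +-cong (*-cong (natC-* (suc n) (n !)) refl) refl ⟨
    natC (suc n !) * EQ (suc n) + α * x * (N * EQ n)
      ≈⟨ +-cong (evalP-fpoly a (α + 1#) (suc n) x) (*-cong refl (evalP-fpoly a (α + 1#) n x)) ⟨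
    evalP (f (suc n)) x + α * x * evalP (f n) x
      ∎
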